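{- For every prime power $q$ and every positive integer $t$ with $t\mid q-1$, the graph $G(q^2,t(q+1))$ is $K_{3,2t^2+1}$-free.
   Context: For a prime power $Q$ and a positive integer $s$ with $s\mid Q-1$, let $\mathbf{F}=\mathrm{GF}(Q)$ and let $H\subseteq\mathbf{F}^\ast$ be the (unique) subgroup of the multiplicative group of order $s$. The graph $G(Q,s)$ has vertex set $(\mathbf{F}\times\mathbf{F}\setminus\{(0,0)\})/\sim$, where $(a_1,b_1)\sim(a_2,b_2)$ iff there is $h\in H$ with $a_1=ha_2$ and $b_1=hb_2$; write $\langle a,b\rangle$ for the class of $(a,b)$. Two distinct vertices $\langle a,b\rangle$ and $\langle x,y\rangle$ are adjacent iff $ax+by\in H$ (this is well defined; the graph is simple, without loops). Note $t(q+1)\mid q^2-1$. A graph is $K_{m,n}$-free if it contains no (not necessarily induced) subgraph isomorphic to the complete bipartite graph $K_{m,n}$. -}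

module Defs where

open import Level using (0ℓ)
open import Data.Nat using (ℕ; _^_; _≥_)
open import Data.Nat.Primality using (Prime)
open import Data.Fin using (Fin)
open import Data.Bool using (Bool; true)
open import Data.Product using (Σ; ∃; _×_; _,_)
open import Data.Empty using (⊥)
open import Relation.Nullary using (¬_)
open import Relation.Binary.PropositionalEquality using (_≡_)
open import Function.Bundles using (_↔_)
open import Algebra.Structures using (IsCommutativeRing)

IsPrimePower : ℕ → Set
IsPrimePower q = ∃ λ p → ∃ λ k → Prime p × k ≥ 1 × q ≡ p ^ k

record FiniteField : Set₁ where
  field
    Carrier : Set
    _+_ _*_ : Carrier → Carrier → Carrier
    -_ : Carrier → Carrier
    0# 1# : Carrier
    isCommutativeRing : IsCommutativeRing _≡_ _+_ _*_ -_ 0# 1#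
    0≢1 : ¬ (0# ≡ 1#)
    _⁻¹ : Carrier → Carrier
    inverseʳ : ∀ x → ¬ (x ≡ 0#) → x * (x ⁻¹) ≡ 1#
    order : ℕ
    enumeration : Fin order ↔ Carrier

record IsSubgroupOfOrder (F : FiniteField) (H : FiniteField.Carrier F → Bool) (s : ℕ) : Set where
  open FiniteField F
  field
    nonzero   : ∀ x → H x ≡ true → ¬ (x ≡ 0#)
    one∈      : H 1# ≡ true
    mul-closed : ∀ x y → H x ≡ true → H y ≡ true → H (x * y) ≡ true
    inv-closed : ∀ x → H x ≡ true → H (x ⁻¹) ≡ true
    size      : Fin s ↔ Σ Carrier (λ x → H x ≡ true)

-- A (simple) graph whose vertex set is a type V modulo an equivalence _≈_
-- (used to represent quotient vertex sets), with adjacency Adj.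
record Graph : Set₁ where
  field
    V   : Set
    _≈_ : V → V → Set
    Adj : V → V → Set

ContainsK : Graph → ℕ → ℕ → Set
ContainsK G m n =
  Σ (Fin m → V) λ f → Σ (Fin n → V) λ g →
    (∀ i j → f i ≈ f j → i ≡ j) ×
    (∀ i j → g i ≈ g j → i ≡ j) ×
    (∀ i j → ¬ (f i ≈ g j)) ×
    (∀ i j → Adj (f i) (g j))
  where open Graph G

KFree : Graph → ℕ → ℕ → Set
KFree G m n = ¬ ContainsK G m n

module _ (F : FiniteField) (H : FiniteField.Carrier F → Bool) where
  open FiniteField F

  NonzeroPair : Set
  NonzeroPair = Σ (Carrier × Carrier) λ { (a , b) → ¬ (a ≡ 0# × b ≡ 0#) }

  _∼_ : NonzeroPair → NonzeroPair → Set
  ((a₁ , b₁) , _) ∼ ((a₂ , b₂) , _) =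
    ∃ λ h → H h ≡ true × a₁ ≡ h * a₂ × b₁ ≡ h * b₂

  Adjacent : NonzeroPair → NonzeroPair → Set
  Adjacent u@((a , b) , _) v@((x , y) , _) =
    ¬ (u ∼ v) × H ((a * x) + (b * y)) ≡ true

  GQs : Graph
  GQs = record { V = NonzeroPair ; _≈_ = _∼_ ; Adj = Adjacent }

module Submission where

-- Let f₀, f₁, f₂ be pairwise non-equivalent vertices with a common neighbour. Their
-- dot products with it lie in H, so two of them with vanishing determinant would differ
-- by a factor from H; hence they are pairwise independent and f₂ = α f₀ + β f₁ with
-- α β ≠ 0. For a common neighbour w, h = (f₁·w)/(f₀·w) and α + β h = (f₂·w)/(f₀·w) lie
-- in H, and h determines w up to equivalence. With σ x = x^q and N x = x σ(x) = x^(q+1),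
-- the norm of every element of H is one of the at most t roots of X^t - 1. Since σ is
-- additive, two distinct z, z′ with N z = N z′ and N (α + z) = N (α + z′) satisfy
-- z′ = α σ(z) / σ(α) and vice versa, so N h, N (α + β h) and one bit determine z = β h.
-- Hence three vertices have at most 2t² common neighbours.

open import Level using (0ℓ)
open import Algebra.Bundles using (CommutativeRing; CommutativeMonoid)
import Algebra.Properties.CommutativeMonoid.Sum as MonoidSum
import Algebra.Properties.CommutativeSemiring.Binomial as Binomial
import Algebra.Solver.Ring as RingSolver
import Algebra.Solver.Ring.AlmostCommutativeRing as ACR
open import Axiom.UniquenessOfIdentityProofs using (module Decidable⇒UIP)
open import Data.Bool using (Bool; true)
import Data.Bool as Bool
open import Data.Empty using (⊥-elim)
open import Data.Fin as Fin using (Fin)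
open import Data.Fin.Patterns using (0F; 1F; 2F)
import Data.Fin.Properties as Fin
open import Data.Integer as ℤ using (ℤ; -[1+_]; _⊖_) renaming (+_ to +ℤ_)
import Data.Integer.Properties as ℤ
open import Data.List using (List; []; _∷_; length; filter; map; allFin; lookup)
open import Data.List.Membership.Propositional using (_∈_)
open import Data.List.Membership.Propositional.Properties using (∈-filter⁺; ∈-map⁺; ∈-allFin)
open import Data.List.Relation.Unary.All as All using (All; []; _∷_)
open import Data.List.Relation.Unary.All.Properties using (all-filter)
open import Data.List.Relation.Unary.AllPairs using ([]; _∷_)
import Data.List.Relation.Unary.Any as Any
open import Data.List.Relation.Unary.Any.Properties using (lookup-index)
open import Data.List.Relation.Unary.Unique.Propositional using (Unique)
import Data.List.Relation.Unary.Unique.Propositional.Properties as Unique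
open import Data.Maybe using (Maybe; just; nothing)
open import Data.Nat as ℕ using (ℕ; zero; suc; _∸_; _!)
open import Data.Nat.Combinatorics using (_C_; nCn≡1; nCk≡n!/k![n-k]!; k![n∸k]!∣n!)
open import Data.Nat.Divisibility using (_∣_; _∤_; divides; ∣1⇒≡1; ∣⇒≤; m∣m*n)
open import Data.Nat.DivMod using (m/n*n≡m)
open import Data.Nat.Primality using (Prime; euclidsLemma; prime⇒nonTrivial)
import Data.Nat.Properties as ℕ
open import Data.Product using (Σ; _,_; proj₁; proj₂)
open import Data.Sum using (_⊎_; inj₁; inj₂)
open import Data.Vec.Functional using (replicate)
open import Function using (_∘_; id; Inverse; Injection; _↔_; mk↔ₛ′)
open import Function.Properties.Inverse using (↔-trans; ↔-sym; ↔⇒↣)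
open import Relation.Binary.Definitions using (tri<; tri≈; tri>)
open import Relation.Binary.PropositionalEquality as ≡ using (_≡_; _≢_; refl; cong; cong₂; subst; module ≡-Reasoning)
open import Relation.Nullary using (¬_; Dec; yes; no; does)
open import Relation.Nullary.Decidable using (map′; dec-true; dec-false)

open import Defs

p∤n! : ∀ {p} → Prime p → ∀ n → n ℕ.< p → p ∤ n !
p∤n! p-prime zero    _   p∣1      = ℕ.<-irrefl (≡.sym (∣1⇒≡1 p∣1)) (ℕ.nonTrivial⇒n>1 _ {{prime⇒nonTrivial p-prime}})
p∤n! p-prime (suc n) n<p p∣[1+n]! with euclidsLemma (suc n) (n !) p-prime p∣[1+n]!
... | inj₁ p∣1+n = ℕ.<⇒≱ n<p (∣⇒≤ p∣1+n)
... | inj₂ p∣n!  = p∤n! p-prime n (ℕ.<-trans (ℕ.n<1+n n) n<p) p∣n!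

p∣pCk : ∀ {p k} → Prime p → 0 ℕ.< k → k ℕ.< p → p ∣ p C k
p∣pCk {p@(suc p-1)} {k} p-prime 0<k k<p
  with euclidsLemma (p C k) (k ! ℕ.* (p ∸ k) !) p-prime (subst (p ∣_) (≡.sym pCk*k!*[p-k]!≡p!) (m∣m*n (p-1 !)))
  where
  instance
    k!*[p-k]!≢0 : ℕ.NonZero (k ! ℕ.* (p ∸ k) !)
    k!*[p-k]!≢0 = ℕ._!*_!≢0 k (p ∸ k)
  pCk*k!*[p-k]!≡p! : (p C k) ℕ.* (k ! ℕ.* (p ∸ k) !) ≡ p !
  pCk*k!*[p-k]!≡p! = ≡.trans (cong (ℕ._* (k ! ℕ.* (p ∸ k) !)) (nCk≡n!/k![n-k]! (ℕ.<⇒≤ k<p))) (m/n*n≡m (k![n∸k]!∣n! (ℕ.<⇒≤ k<p)))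
... | inj₁ p∣pCk = p∣pCk
... | inj₂ p∣k!*[p-k]! with euclidsLemma (k !) ((p ∸ k) !) p-prime p∣k!*[p-k]!
...   | inj₁ p∣k!     = ⊥-elim (p∤n! p-prime k k<p p∣k!)
...   | inj₂ p∣[p-k]! = ⊥-elim (p∤n! p-prime (p ∸ k) (ℕ.∸-monoʳ-< 0<k (ℕ.<⇒≤ k<p)) p∣[p-k]!)

module _ {c ℓ} (M : CommutativeMonoid c ℓ) where
  open CommutativeMonoid M
  open MonoidSum M using (sum; sum-permute; sum-cong-≗; sum-cong-≋; ∑-distrib-+; sum-replicate)
  open import Algebra.Definitions.RawMonoid rawMonoid using (_×_)
  open import Relation.Binary.Reasoning.Setoid setoid

  sum-invariant : ∀ {A : Set} {n} (e : Fin n ↔ A) (φ : A ↔ A) (f : A → Carrier) (c : Carrier) →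
                  (∀ a → f (Inverse.to φ a) ≈ c ∙ f a) →
                  n × c ∙ sum (f ∘ Inverse.to e) ≈ sum (f ∘ Inverse.to e)
  sum-invariant {n = n} e φ f c f∘φ≈c∙f = begin
    n × c ∙ sum (f ∘ to e)                    ≈⟨ ∙-congʳ (sym (sum-replicate n)) ⟩
    sum (replicate n c) ∙ sum (f ∘ to e)      ≈⟨ sym (∑-distrib-+ (replicate n c) (f ∘ to e)) ⟩
    sum (λ i → c ∙ f (to e i))                ≈⟨ sym (sum-cong-≋ (f∘φ≈c∙f ∘ to e)) ⟩
    sum (f ∘ to φ ∘ to e)                     ≡⟨ sum-cong-≗ {n} (λ i → cong f (≡.sym (Inverse.strictlyInverseˡ e (to φ (to e i))))) ⟩
    sum (f ∘ to e ∘ to π)                     ≈⟨ sym (sum-permute (f ∘ to e) π) ⟩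
    sum (f ∘ to e)                            ∎
    where
    open Inverse using (to)
    π : Fin n ↔ Fin n
    π = ↔-trans e (↔-trans φ (↔-sym e))


does-<?-asym : ∀ {n} {i j : Fin n} → i ≢ j → does (i Fin.<? j) ≢ does (j Fin.<? i)
does-<?-asym {i = i} {j} i≢j with Fin.<-cmp i j
... | tri< i<j _ j≮i rewrite dec-true (i Fin.<? j) i<j | dec-false (j Fin.<? i) j≮i = λ ()
... | tri≈ _ i≡j _                                                                 = ⊥-elim (i≢j i≡j)
... | tri> i≮j _ j<i rewrite dec-false (i Fin.<? j) i≮j | dec-true (j Fin.<? i) j<i = λ ()

module Field (F : FiniteField) where
  open FiniteField F public using (_⁻¹; inverseʳ; 0≢1; order; enumeration)

  commutativeRing : CommutativeRing 0ℓ 0ℓ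
  commutativeRing = record { isCommutativeRing = FiniteField.isCommutativeRing F }

  open CommutativeRing commutativeRing public hiding (refl; sym; trans)
  open import Algebra.Properties.Ring ring public
  open import Algebra.Properties.Semiring.Mult semiring public
  open import Algebra.Properties.Semiring.Exp semiring public
  open import Algebra.Properties.CommutativeSemiring.Exp commutativeSemiring public using (^-distrib-*)
  open import Algebra.Properties.CommutativeSemigroup +-commutativeSemigroup using ()
    renaming (interchange to +-interchange)
  open ≡-Reasoning

  -- The ring solver below works with integer coefficients, interpreted along fromℤ.
  fromℤ : ℤ → Carrier
  fromℤ (+ℤ n)    = n × 1#
  fromℤ -[1+ n ] = - (suc n × 1#)

  fromℤ-⊖ : ∀ m n → fromℤ (m ⊖ n) ≡ m × 1# - n × 1#
  fromℤ-⊖ m       zero    = begin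
    fromℤ (m ⊖ 0)      ≡⟨ cong fromℤ (ℤ.⊖-≥ {m} ℕ.z≤n) ⟩
    m × 1#             ≡⟨ ≡.sym (+-identityʳ _) ⟩
    m × 1# + 0#        ≡⟨ cong (m × 1# +_) (≡.sym -0#≈0#) ⟩
    m × 1# - 0 × 1#    ∎
  fromℤ-⊖ zero    (suc n) = ≡.sym (+-identityˡ _)
  fromℤ-⊖ (suc m) (suc n) = begin
    fromℤ (suc m ⊖ suc n)                       ≡⟨ cong fromℤ (ℤ.[1+m]⊖[1+n]≡m⊖n m n) ⟩
    fromℤ (m ⊖ n)                               ≡⟨ fromℤ-⊖ m n ⟩
    m × 1# - n × 1#                             ≡⟨ ≡.sym (+-identityˡ _) ⟩
    0# + (m × 1# - n × 1#)                      ≡⟨ cong (_+ (m × 1# - n × 1#)) (≡.sym (-‿inverseʳ 1#)) ⟩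
    (1# - 1#) + (m × 1# - n × 1#)               ≡⟨ +-interchange 1# (- 1#) (m × 1#) (- (n × 1#)) ⟩
    suc m × 1# + (- 1# + - (n × 1#))            ≡⟨ cong (suc m × 1# +_) (-‿+-comm 1# (n × 1#)) ⟩
    suc m × 1# - suc n × 1#                     ∎

  fromℤ-+ : ∀ i j → fromℤ (i ℤ.+ j) ≡ fromℤ i + fromℤ j
  fromℤ-+ (+ℤ m)    (+ℤ n)    = ×-homo-+ 1# m n
  fromℤ-+ (+ℤ m)    -[1+ n ] = fromℤ-⊖ m (suc n)
  fromℤ-+ -[1+ m ] (+ℤ n)    = ≡.trans (fromℤ-⊖ n (suc m)) (+-comm _ _)
  fromℤ-+ -[1+ m ] -[1+ n ] = begin
    - (suc (suc (m ℕ.+ n)) × 1#)      ≡⟨ cong (λ k → - (k × 1#)) (≡.sym (ℕ.+-suc (suc m) n)) ⟩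
    - ((suc m ℕ.+ suc n) × 1#)        ≡⟨ cong -_ (×-homo-+ 1# (suc m) (suc n)) ⟩
    - (suc m × 1# + suc n × 1#)       ≡⟨ -‿+-comm _ _ ⟨
    - (suc m × 1#) + - (suc n × 1#)   ∎

  fromℤ-neg : ∀ i → fromℤ (ℤ.- i) ≡ - fromℤ i
  fromℤ-neg -[1+ n ]       = ≡.sym (-‿involutive _)
  fromℤ-neg (+ℤ zero)      = ≡.sym -0#≈0#
  fromℤ-neg (+ℤ (suc n))   = refl

  fromℤ-*-+ : ∀ m j → fromℤ (+ℤ m ℤ.* j) ≡ fromℤ (+ℤ m) * fromℤ j
  fromℤ-*-+ m (+ℤ n)    = ≡.trans (cong fromℤ (≡.sym (ℤ.pos-* m n))) (×1-homo-* m n)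
  fromℤ-*-+ m -[1+ n ] = begin
    fromℤ (+ℤ m ℤ.* -[1+ n ])              ≡⟨ cong fromℤ (ℤ.neg-distribʳ-* (+ℤ m) (+ℤ suc n)) ⟨
    fromℤ (ℤ.- (+ℤ m ℤ.* +ℤ suc n))        ≡⟨ fromℤ-neg (+ℤ m ℤ.* +ℤ suc n) ⟩
    - fromℤ (+ℤ m ℤ.* +ℤ suc n)            ≡⟨ cong -_ (fromℤ-*-+ m (+ℤ suc n)) ⟩
    - (fromℤ (+ℤ m) * fromℤ (+ℤ suc n))    ≡⟨ -‿distribʳ-* _ _ ⟩
    fromℤ (+ℤ m) * fromℤ -[1+ n ]          ∎

  fromℤ-* : ∀ i j → fromℤ (i ℤ.* j) ≡ fromℤ i * fromℤ j
  fromℤ-* (+ℤ m)    j = fromℤ-*-+ m j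
  fromℤ-* -[1+ m ] j = begin
    fromℤ (-[1+ m ] ℤ.* j)                 ≡⟨ cong fromℤ (ℤ.neg-distribˡ-* (+ℤ suc m) j) ⟨
    fromℤ (ℤ.- (+ℤ suc m ℤ.* j))           ≡⟨ fromℤ-neg (+ℤ suc m ℤ.* j) ⟩
    - fromℤ (+ℤ suc m ℤ.* j)               ≡⟨ cong -_ (fromℤ-*-+ (suc m) j) ⟩
    - (fromℤ (+ℤ suc m) * fromℤ j)         ≡⟨ -‿distribˡ-* _ _ ⟩
    fromℤ -[1+ m ] * fromℤ j               ∎

  almostCommutativeRing : ACR.AlmostCommutativeRing 0ℓ 0ℓ
  almostCommutativeRing = ACR.fromCommutativeRing commutativeRing

  fromℤ-homomorphism : ℤ.+-*-rawRing ACR.-Raw-AlmostCommutative⟶ almostCommutativeRing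
  fromℤ-homomorphism = record
    { ⟦_⟧ = fromℤ ; +-homo = fromℤ-+ ; *-homo = fromℤ-* ; -‿homo = fromℤ-neg
    ; 0-homo = refl ; 1-homo = +-identityʳ 1# }

  fromℤ-≟ : ∀ i j → Maybe (fromℤ i ≡ fromℤ j)
  fromℤ-≟ i j with i ℤ.≟ j
  ... | yes i≡j = just (cong fromℤ i≡j)
  ... | no  _   = nothing

  open RingSolver ℤ.+-*-rawRing almostCommutativeRing fromℤ-homomorphism fromℤ-≟ public
    using (solve; _:=_; _:+_; _:-_; _:*_; :-_; con)

  index : Carrier → Fin order
  index = Inverse.from enumeration

  index-injective : ∀ {x y} → index x ≡ index y → x ≡ y
  index-injective {x} {y} eq = begin
    x                  ≡⟨ Inverse.strictlyInverseˡ enumeration x ⟨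
    to (index x)       ≡⟨ cong to eq ⟩
    to (index y)       ≡⟨ Inverse.strictlyInverseˡ enumeration y ⟩
    y                  ∎
    where open Inverse enumeration using (to)

  infix 4 _≟_
  _≟_ : (x y : Carrier) → Dec (x ≡ y)
  x ≟ y = map′ index-injective (cong index) (index x Fin.≟ index y)

  inverseˡ : ∀ x → x ≢ 0# → x ⁻¹ * x ≡ 1#
  inverseˡ x x≢0 = ≡.trans (*-comm _ _) (inverseʳ x x≢0)

  *-cancelˡ : ∀ x {y z} → x ≢ 0# → x * y ≡ x * z → y ≡ z
  *-cancelˡ x {y} {z} x≢0 eq = begin
    y                  ≡⟨ *-identityˡ y ⟨
    1# * y             ≡⟨ cong (_* y) (inverseˡ x x≢0) ⟨
    x ⁻¹ * x * y       ≡⟨ *-assoc _ _ _ ⟩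
    x ⁻¹ * (x * y)     ≡⟨ cong (x ⁻¹ *_) eq ⟩
    x ⁻¹ * (x * z)     ≡⟨ *-assoc _ _ _ ⟨
    x ⁻¹ * x * z       ≡⟨ cong (_* z) (inverseˡ x x≢0) ⟩
    1# * z             ≡⟨ *-identityˡ z ⟩
    z                  ∎

  x*y*y⁻¹≡x : ∀ x {y} → y ≢ 0# → x * y * y ⁻¹ ≡ x
  x*y*y⁻¹≡x x {y} y≢0 = begin
    x * y * y ⁻¹       ≡⟨ *-assoc x y (y ⁻¹) ⟩
    x * (y * y ⁻¹)     ≡⟨ cong (x *_) (inverseʳ y y≢0) ⟩
    x * 1#             ≡⟨ *-identityʳ x ⟩
    x                  ∎

  x*y⁻¹*y≡x : ∀ x {y} → y ≢ 0# → x * y ⁻¹ * y ≡ x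
  x*y⁻¹*y≡x x {y} y≢0 = begin
    x * y ⁻¹ * y       ≡⟨ *-assoc x (y ⁻¹) y ⟩
    x * (y ⁻¹ * y)     ≡⟨ cong (x *_) (inverseˡ y y≢0) ⟩
    x * 1#             ≡⟨ *-identityʳ x ⟩
    x                  ∎

  x*y≡0⇒x≡0⊎y≡0 : ∀ x y → x * y ≡ 0# → x ≡ 0# ⊎ y ≡ 0#
  x*y≡0⇒x≡0⊎y≡0 x y xy≡0 with x ≟ 0#
  ... | yes x≡0 = inj₁ x≡0
  ... | no  x≢0 = inj₂ (*-cancelˡ x x≢0 (≡.trans xy≡0 (≡.sym (zeroʳ x))))

  x*y≢0 : ∀ {x y} → x ≢ 0# → y ≢ 0# → x * y ≢ 0#
  x*y≢0 {x} {y} x≢0 y≢0 xy≡0 with x*y≡0⇒x≡0⊎y≡0 x y xy≡0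
  ... | inj₁ x≡0 = x≢0 x≡0
  ... | inj₂ y≡0 = y≢0 y≡0

  x⁻¹≢0 : ∀ {x} → x ≢ 0# → x ⁻¹ ≢ 0#
  x⁻¹≢0 {x} x≢0 x⁻¹≡0 = 0≢1 (begin
    0#          ≡⟨ zeroʳ x ⟨
    x * 0#      ≡⟨ cong (x *_) x⁻¹≡0 ⟨
    x * x ⁻¹    ≡⟨ inverseʳ x x≢0 ⟩
    1#          ∎)

  x^n≢0 : ∀ {x} n → x ≢ 0# → x ^ n ≢ 0#
  x^n≢0 zero    x≢0 = 0≢1 ∘ ≡.sym
  x^n≢0 (suc n) x≢0 = x*y≢0 x≢0 (x^n≢0 n x≢0)

  x^[1+n]≡0⇒x≡0 : ∀ {x} n → x ^ suc n ≡ 0# → x ≡ 0#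
  x^[1+n]≡0⇒x≡0 {x} n xⁿ≡0 with x ≟ 0#
  ... | yes x≡0 = x≡0
  ... | no  x≢0 = ⊥-elim (x^n≢0 (suc n) x≢0 xⁿ≡0)

  -1≢0 : - 1# ≢ 0#
  -1≢0 -1≡0 = 0≢1 (begin
    0#         ≡⟨ -0#≈0# ⟨
    - 0#       ≡⟨ cong -_ -1≡0 ⟨
    - - 1#     ≡⟨ -‿involutive 1# ⟩
    1#         ∎)

module Frobenius (F : FiniteField) where
  open Field F
  open ≡-Reasoning

  order×1≡0 : order × 1# ≡ 0#
  order×1≡0 = +-identityˡ-unique (order × 1#) (sum (Inverse.to enumeration))
    (sum-invariant +-commutativeMonoid enumeration (mk↔ₛ′ (1# +_) (- 1# +_) 1+[-1+x]≡x -1+[1+x]≡x) id 1# (λ _ → refl))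
    where
    open import Algebra.Definitions.RawMonoid +-rawMonoid using (sum)
    1+[-1+x]≡x : ∀ x → 1# + (- 1# + x) ≡ x
    1+[-1+x]≡x = solve 2 (λ o x → o :+ (:- o :+ x) := x) refl 1#
    -1+[1+x]≡x : ∀ x → - 1# + (1# + x) ≡ x
    -1+[1+x]≡x = solve 2 (λ o x → :- o :+ (o :+ x) := x) refl 1#

  ×1-homo-^ : ∀ m n → (m ℕ.^ n) × 1# ≡ (m × 1#) ^ n
  ×1-homo-^ m zero    = +-identityʳ 1#
  ×1-homo-^ m (suc n) = ≡.trans (×1-homo-* m (m ℕ.^ n)) (cong ((m × 1#) *_) (×1-homo-^ m n))

  n×1≡0⇒n×x≡0 : ∀ {n} → n × 1# ≡ 0# → ∀ x → n × x ≡ 0#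
  n×1≡0⇒n×x≡0 {n} n×1≡0 x = begin
    n × x            ≡⟨ cong (n ×_) (*-identityˡ x) ⟨
    n × (1# * x)     ≡⟨ ×-assoc-* n 1# x ⟨
    (n × 1#) * x     ≡⟨ cong (_* x) n×1≡0 ⟩
    0# * x           ≡⟨ zeroˡ x ⟩
    0#               ∎

  p∣n⇒n×x≡0 : ∀ {p n} → p × 1# ≡ 0# → p ∣ n → ∀ x → n × x ≡ 0#
  p∣n⇒n×x≡0 {p} p×1≡0 (divides c refl) = n×1≡0⇒n×x≡0 {c ℕ.* p} (begin
    (c ℕ.* p) × 1#          ≡⟨ ×1-homo-* c p ⟩
    (c × 1#) * (p × 1#)     ≡⟨ cong ((c × 1#) *_) p×1≡0 ⟩
    (c × 1#) * 0#           ≡⟨ zeroʳ _ ⟩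
    0#                      ∎)

  private
    open import Algebra.Definitions.RawMonoid +-rawMonoid using (sum)

    sum-ends : ∀ m (f : Fin (suc (suc m)) → Carrier) → (∀ i → f (Fin.suc (Fin.inject₁ i)) ≡ 0#) →
               sum f ≡ f Fin.zero + f (Fin.fromℕ (suc m))
    sum-ends zero    f middle≡0 = cong (f Fin.zero +_) (+-identityʳ _)
    sum-ends (suc m) f middle≡0 = cong (f Fin.zero +_) (begin
      sum (f ∘ Fin.suc)                               ≡⟨ sum-ends m (f ∘ Fin.suc) (middle≡0 ∘ Fin.suc) ⟩
      f (Fin.suc Fin.zero) + f (Fin.fromℕ (suc (suc m))) ≡⟨ cong (_+ _) (middle≡0 Fin.zero) ⟩
      0# + f (Fin.fromℕ (suc (suc m)))                ≡⟨ +-identityˡ _ ⟩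
      f (Fin.fromℕ (suc (suc m)))                     ∎)

  frobenius : ∀ {p} → Prime p → p × 1# ≡ 0# → ∀ x y → (x + y) ^ p ≡ x ^ p + y ^ p
  frobenius {p} p-prime p×1≡0 x y with ℕ.nonTrivial⇒n>1 p {{prime⇒nonTrivial p-prime}}
  ... | ℕ.s≤s (ℕ.s≤s {n = m} ℕ.z≤n) = begin
    (x + y) ^ p                 ≡⟨ theorem p x y ⟩
    binomialExpansion x y p     ≡⟨ sum-ends (suc m) (binomialTerm x y p) middle≡0 ⟩
    binomialTerm x y p Fin.zero + binomialTerm x y p (Fin.fromℕ p)  ≡⟨ cong₂ _+_ first≡yᵖ (last≡xⁿ p) ⟩
    y ^ p + x ^ p               ≡⟨ +-comm _ _ ⟩
    x ^ p + y ^ p               ∎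
    where
    open Binomial commutativeSemiring using (theorem; binomialExpansion; binomialTerm)
    middle≡0 : ∀ i → binomialTerm x y p (Fin.suc (Fin.inject₁ i)) ≡ 0#
    middle≡0 i = p∣n⇒n×x≡0 p×1≡0 (p∣pCk p-prime (ℕ.s≤s ℕ.z≤n) (ℕ.s≤s (subst (ℕ._< suc m) (≡.sym (Fin.toℕ-inject₁ i)) (Fin.toℕ<n i)))) _
    first≡yᵖ : binomialTerm x y p Fin.zero ≡ y ^ p
    first≡yᵖ = ≡.trans (+-identityʳ _) (*-identityˡ _)
    last≡xⁿ : ∀ n → binomialTerm x y n (Fin.fromℕ n) ≡ x ^ n
    last≡xⁿ n rewrite Fin.toℕ-fromℕ n | nCn≡1 n | ℕ.n∸n≡0 n = ≡.trans (+-identityʳ _) (*-identityʳ _)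

  frobenius-^ : ∀ {p} → Prime p → p × 1# ≡ 0# → ∀ k x y → (x + y) ^ (p ℕ.^ k) ≡ x ^ (p ℕ.^ k) + y ^ (p ℕ.^ k)
  frobenius-^ p-prime p×1≡0 zero    x y = distribʳ 1# x y
  frobenius-^ {p} p-prime p×1≡0 (suc k) x y = begin
    (x + y) ^ (p ℕ.* p ℕ.^ k)                 ≡⟨ ^-assocʳ (x + y) p (p ℕ.^ k) ⟨
    ((x + y) ^ p) ^ (p ℕ.^ k)                 ≡⟨ cong (_^ (p ℕ.^ k)) (frobenius p-prime p×1≡0 x y) ⟩
    (x ^ p + y ^ p) ^ (p ℕ.^ k)               ≡⟨ frobenius-^ p-prime p×1≡0 k (x ^ p) (y ^ p) ⟩
    (x ^ p) ^ (p ℕ.^ k) + (y ^ p) ^ (p ℕ.^ k) ≡⟨ cong₂ _+_ (^-assocʳ x p (p ℕ.^ k)) (^-assocʳ y p (p ℕ.^ k)) ⟩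
    x ^ (p ℕ.* p ℕ.^ k) + y ^ (p ℕ.* p ℕ.^ k) ∎

  prime-power-order⇒p×1≡0 : ∀ {p m} → order ≡ p ℕ.^ suc m → p × 1# ≡ 0#
  prime-power-order⇒p×1≡0 {p} {m} order≡pᵐ⁺¹ = x^[1+n]≡0⇒x≡0 m (begin
    (p × 1#) ^ suc m        ≡⟨ ×1-homo-^ p (suc m) ⟨
    (p ℕ.^ suc m) × 1#      ≡⟨ cong (_× 1#) order≡pᵐ⁺¹ ⟨
    order × 1#              ≡⟨ order×1≡0 ⟩
    0#                      ∎)

module Lagrange (F : FiniteField) {H : FiniteField.Carrier F → Bool} {s : ℕ} (H-subgroup : IsSubgroupOfOrder F H s) where
  open Field F
  open ≡-Reasoning
  open IsSubgroupOfOrder H-subgroup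
  open import Algebra.Definitions.RawMonoid *-rawMonoid using () renaming (sum to product)

  private
    H-elem-≡ : ∀ {x y} {x∈H : H x ≡ true} {y∈H : H y ≡ true} → x ≡ y → (x , x∈H) ≡ (y , y∈H)
    H-elem-≡ {x∈H = x∈H} {y∈H} refl = cong (_ ,_) (Decidable⇒UIP.≡-irrelevant Bool._≟_ x∈H y∈H)

    product-≢0 : ∀ {n} (f : Fin n → Carrier) → (∀ i → f i ≢ 0#) → product f ≢ 0#
    product-≢0 {zero}  f f≢0 = 0≢1 ∘ ≡.sym
    product-≢0 {suc n} f f≢0 = x*y≢0 (f≢0 Fin.zero) (product-≢0 (f ∘ Fin.suc) (f≢0 ∘ Fin.suc))

  x∈H⇒x^s≡1 : ∀ x → H x ≡ true → x ^ s ≡ 1#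
  x∈H⇒x^s≡1 x x∈H = *-cancelˡ P P≢0 (begin
    P * x ^ s      ≡⟨ *-comm P _ ⟩
    x ^ s * P      ≡⟨ sum-invariant *-commutativeMonoid size x*-bijection proj₁ x (λ _ → refl) ⟩
    P              ≡⟨ *-identityʳ P ⟨
    P * 1#         ∎)
    where
    P = product (proj₁ ∘ Inverse.to size)
    P≢0 : P ≢ 0#
    P≢0 = product-≢0 _ (λ i → let (y , y∈H) = Inverse.to size i in nonzero y y∈H)
    x≢0 = nonzero x x∈H
    x*-bijection : Σ Carrier (λ y → H y ≡ true) ↔ Σ Carrier (λ y → H y ≡ true)
    x*-bijection = mk↔ₛ′ (λ (y , y∈H) → x * y , mul-closed x y x∈H y∈H)
                      (λ (y , y∈H) → x ⁻¹ * y , mul-closed (x ⁻¹) y (inv-closed x x∈H) y∈H)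
                      (λ _ → H-elem-≡ (cancel (inverseʳ x x≢0)))
                      (λ _ → H-elem-≡ (cancel (inverseˡ x x≢0)))
      where
      cancel : ∀ {a b y} → a * b ≡ 1# → a * (b * y) ≡ y
      cancel {a} {b} {y} ab≡1 = ≡.trans (≡.sym (*-assoc a b y)) (≡.trans (cong (_* y) ab≡1) (*-identityˡ y))

-- Polynomials are lists of coefficients, constant coefficient first.
module Polynomial (F : FiniteField) where
  open Field F
  open ≡-Reasoning

  eval : List Carrier → Carrier → Carrier
  eval []       x = 0#
  eval (c ∷ cs) x = c + x * eval cs x

  quotient : Carrier → List Carrier → List Carrier
  quotient r []                = []
  quotient r (c ∷ [])          = []
  quotient r (c ∷ cs@(_ ∷ _)) = eval cs r ∷ quotient r cs

  eval-quotient : ∀ r cs x → eval cs x ≡ (x - r) * eval (quotient r cs) x + eval cs r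
  eval-quotient r []       x = solve 2 (λ x r → con (+ℤ 0) := (x :- r) :* con (+ℤ 0) :+ con (+ℤ 0)) refl x r
  eval-quotient r (c ∷ []) x =
    solve 3 (λ c x r → c :+ x :* con (+ℤ 0) := (x :- r) :* con (+ℤ 0) :+ (c :+ r :* con (+ℤ 0))) refl c x r
  eval-quotient r (c ∷ cs@(_ ∷ _)) x = begin
    c + x * eval cs x                                             ≡⟨ cong (λ e → c + x * e) (eval-quotient r cs x) ⟩
    c + x * ((x - r) * eval (quotient r cs) x + eval cs r)        ≡⟨ rearrange c x r (eval (quotient r cs) x) (eval cs r) ⟩
    (x - r) * (eval cs r + x * eval (quotient r cs) x) + (c + r * eval cs r) ∎
    where
    rearrange : ∀ c x r q v → c + x * ((x - r) * q + v) ≡ (x - r) * (v + x * q) + (c + r * v)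
    rearrange = solve 5 (λ c x r q v → c :+ x :* ((x :- r) :* q :+ v) := (x :- r) :* (v :+ x :* q) :+ (c :+ r :* v)) refl

  length-quotient : ∀ r cs n → length cs ℕ.≤ suc n → length (quotient r cs) ℕ.≤ n
  length-quotient r []                n       _         = ℕ.z≤n
  length-quotient r (c ∷ [])          n       _         = ℕ.z≤n
  length-quotient r (c ∷ cs@(_ ∷ _)) (suc n) (ℕ.s≤s ≤n) = ℕ.s≤s (length-quotient r cs n ≤n)

  quotient-root : ∀ {r r′ cs} → eval cs r ≡ 0# → r ≢ r′ → eval cs r′ ≡ 0# → eval (quotient r cs) r′ ≡ 0#
  quotient-root {r} {r′} {cs} cs[r]≡0 r≢r′ cs[r′]≡0 with x*y≡0⇒x≡0⊎y≡0 (r′ - r) _ (begin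
    (r′ - r) * eval (quotient r cs) r′                  ≡⟨ +-identityʳ _ ⟨
    (r′ - r) * eval (quotient r cs) r′ + 0#             ≡⟨ cong ((r′ - r) * eval (quotient r cs) r′ +_) cs[r]≡0 ⟨
    (r′ - r) * eval (quotient r cs) r′ + eval cs r      ≡⟨ eval-quotient r cs r′ ⟨
    eval cs r′                                          ≡⟨ cs[r′]≡0 ⟩
    0#                                                  ∎)
  ... | inj₁ r′-r≡0  = ⊥-elim (r≢r′ (≡.sym (x∙y⁻¹≈ε⇒x≈y r′ r r′-r≡0)))
  ... | inj₂ q[r′]≡0 = q[r′]≡0

  roots⇒eval≡0 : ∀ rs cs → Unique rs → All (λ r → eval cs r ≡ 0#) rs → length cs ℕ.≤ length rs →
                 ∀ x → eval cs x ≡ 0#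
  roots⇒eval≡0 []       []      _              _              _   x = refl
  roots⇒eval≡0 (r ∷ rs) cs      (r∉rs ∷ rs!) (cs[r]≡0 ∷ cs[rs]≡0) |cs|≤ x = begin
    eval cs x                                    ≡⟨ eval-quotient r cs x ⟩
    (x - r) * eval (quotient r cs) x + eval cs r ≡⟨ cong₂ (λ q v → (x - r) * q + v) q[x]≡0 cs[r]≡0 ⟩
    (x - r) * 0# + 0#                            ≡⟨ ≡.trans (+-identityʳ _) (zeroʳ _) ⟩
    0#                                           ∎
    where
    q[x]≡0 : eval (quotient r cs) x ≡ 0#
    q[x]≡0 = roots⇒eval≡0 rs (quotient r cs) rs!
               (All.map (λ (r≢r′ , cs[r′]≡0) → quotient-root {cs = cs} cs[r]≡0 r≢r′ cs[r′]≡0) (All.zip (r∉rs , cs[rs]≡0)))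
               (length-quotient r cs _ |cs|≤) x

  monomial : ℕ → List Carrier
  monomial zero    = 1# ∷ []
  monomial (suc n) = 0# ∷ monomial n

  eval-monomial : ∀ n x → eval (monomial n) x ≡ x ^ n
  eval-monomial zero    x = ≡.trans (cong (1# +_) (zeroʳ x)) (+-identityʳ 1#)
  eval-monomial (suc n) x = ≡.trans (+-identityˡ _) (cong (x *_) (eval-monomial n x))

  length-monomial : ∀ n → length (monomial n) ≡ suc n
  length-monomial zero    = refl
  length-monomial (suc n) = cong suc (length-monomial n)

  roots-of-unity-bound : ∀ n rs → Unique rs → All (λ r → r ^ suc n ≡ 1#) rs → length rs ℕ.≤ suc n
  roots-of-unity-bound n rs rs! rsⁿ⁺¹≡1 with length rs ℕ.≤? suc n
  ... | yes |rs|≤ = |rs|≤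
  ... | no  |rs|≰ = ⊥-elim (-1≢0 (begin
    - 1#                                ≡⟨ +-identityʳ _ ⟨
    - 1# + 0#                           ≡⟨ cong (- 1# +_) (zeroˡ _) ⟨
    eval (- 1# ∷ monomial n) 0#         ≡⟨ roots⇒eval≡0 rs (- 1# ∷ monomial n) rs! (Xⁿ⁺¹-1-roots rsⁿ⁺¹≡1)
                                             (subst (ℕ._≤ length rs) (cong suc (≡.sym (length-monomial n))) (ℕ.≰⇒> |rs|≰)) 0# ⟩
    0#                                  ∎))
    where
    Xⁿ⁺¹-1-roots : ∀ {rs} → All (λ r → r ^ suc n ≡ 1#) rs → All (λ r → eval (- 1# ∷ monomial n) r ≡ 0#) rs
    Xⁿ⁺¹-1-roots []                  = []
    Xⁿ⁺¹-1-roots {r ∷ _} (rⁿ⁺¹≡1 ∷ rest) = (begin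
      - 1# + r * eval (monomial n) r    ≡⟨ cong (λ e → - 1# + r * e) (eval-monomial n r) ⟩
      - 1# + r ^ suc n                  ≡⟨ cong (- 1# +_) rⁿ⁺¹≡1 ⟩
      - 1# + 1#                         ≡⟨ -‿inverseˡ 1# ⟩
      0#                                ∎) ∷ Xⁿ⁺¹-1-roots rest

  elements : List Carrier
  elements = map (Inverse.to enumeration) (allFin order)

  elements-unique : Unique elements
  elements-unique = Unique.map⁺ (Injection.injective (↔⇒↣ enumeration)) (Unique.allFin⁺ order)

  ∈-elements : ∀ x → x ∈ elements
  ∈-elements x = subst (_∈ elements) (Inverse.strictlyInverseˡ enumeration x)
                       (∈-map⁺ (Inverse.to enumeration) (∈-allFin (index x)))

  module RootsOfUnity (n : ℕ) where
    private
      isRoot? : ∀ c → Dec (c ^ suc n ≡ 1#)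
      isRoot? c = c ^ suc n ≟ 1#

      roots : List Carrier
      roots = filter isRoot? elements

      |roots|≤1+n : length roots ℕ.≤ suc n
      |roots|≤1+n = roots-of-unity-bound n roots (Unique.filter⁺ isRoot? elements-unique) (all-filter isRoot? elements)

      ∈-roots : ∀ {c} → c ^ suc n ≡ 1# → c ∈ roots
      ∈-roots {c} cⁿ⁺¹≡1 = ∈-filter⁺ isRoot? (∈-elements c) cⁿ⁺¹≡1

    rootIndex : ∀ c → c ^ suc n ≡ 1# → Fin (suc n)
    rootIndex c cⁿ⁺¹≡1 = Fin.inject≤ (Any.index (∈-roots cⁿ⁺¹≡1)) |roots|≤1+n

    rootIndex-injective : ∀ {c d} (cⁿ⁺¹≡1 : c ^ suc n ≡ 1#) (dⁿ⁺¹≡1 : d ^ suc n ≡ 1#) →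
                          rootIndex c cⁿ⁺¹≡1 ≡ rootIndex d dⁿ⁺¹≡1 → c ≡ d
    rootIndex-injective cⁿ⁺¹≡1 dⁿ⁺¹≡1 eq = begin
      _                                       ≡⟨ lookup-index (∈-roots cⁿ⁺¹≡1) ⟩
      lookup roots (Any.index (∈-roots cⁿ⁺¹≡1)) ≡⟨ cong (lookup roots) (Fin.inject≤-injective _ _ _ _ eq) ⟩
      lookup roots (Any.index (∈-roots dⁿ⁺¹≡1)) ≡⟨ lookup-index (∈-roots dⁿ⁺¹≡1) ⟨
      _                                       ∎

module Plane (F : FiniteField) where
  open Field F hiding (_×_)
  open import Data.Product using (_×_)
  open ≡-Reasoning

  Point : Set
  Point = Carrier × Carrier

  infixl 7 _·_
  _·_ : Point → Point → Carrier
  (a , b) · (x , y) = a * x + b * y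

  det : Point → Point → Carrier
  det (a , b) (c , d) = a * d - c * b

  infixr 8 _⊙_
  _⊙_ : Carrier → Point → Point
  h ⊙ (x , y) = h * x , h * y

  ·-⊙ : ∀ u h w → u · (h ⊙ w) ≡ h * (u · w)
  ·-⊙ (a , b) h (x , y) = solve 5 (λ a b h x y → a :* (h :* x) :+ b :* (h :* y) := h :* (a :* x :+ b :* y)) refl a b h x y

  det≡0⇒⊙ : ∀ u v w → det u v ≡ 0# → v · w ≢ 0# → u ≡ (u · w * (v · w) ⁻¹) ⊙ v
  det≡0⇒⊙ u@(a , b) v@(c , d) w@(x , y) det≡0 v·w≢0 = cong₂ _,_
    (divide-by-v·w a c (begin
      a * (v · w)                 ≡⟨ solve 6 (λ a b c d x y → a :* (c :* x :+ d :* y) := (a :* x :+ b :* y) :* c :+ y :* (a :* d :- c :* b)) refl a b c d x y ⟩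
      u · w * c + y * det u v     ≡⟨ cong (λ e → u · w * c + y * e) det≡0 ⟩
      u · w * c + y * 0#          ≡⟨ ≡.trans (cong (u · w * c +_) (zeroʳ y)) (+-identityʳ _) ⟩
      u · w * c                   ∎))
    (divide-by-v·w b d (begin
      b * (v · w)                 ≡⟨ solve 6 (λ a b c d x y → b :* (c :* x :+ d :* y) := (a :* x :+ b :* y) :* d :- x :* (a :* d :- c :* b)) refl a b c d x y ⟩
      u · w * d - x * det u v     ≡⟨ cong (λ e → u · w * d - x * e) det≡0 ⟩
      u · w * d - x * 0#          ≡⟨ ≡.trans (cong (λ e → u · w * d - e) (zeroʳ x)) (≡.trans (cong (u · w * d +_) -0#≈0#) (+-identityʳ _)) ⟩
      u · w * d                   ∎))
    where
    divide-by-v·w : ∀ z e → z * (v · w) ≡ u · w * e → z ≡ u · w * (v · w) ⁻¹ * e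
    divide-by-v·w z e z*W≡U*e = begin
      z                                ≡⟨ x*y*y⁻¹≡x z v·w≢0 ⟨
      z * (v · w) * (v · w) ⁻¹         ≡⟨ cong (_* (v · w) ⁻¹) z*W≡U*e ⟩
      u · w * e * (v · w) ⁻¹           ≡⟨ solve 3 (λ U e V → U :* e :* V := U :* V :* e) refl (u · w) e ((v · w) ⁻¹) ⟩
      u · w * (v · w) ⁻¹ * e           ∎

  cramer : ∀ u v f → det u v ≢ 0# → ∀ w → det f v * det u v ⁻¹ * (u · w) + det u f * det u v ⁻¹ * (v · w) ≡ f · w
  cramer u@(a₀ , b₀) v@(a₁ , b₁) f@(a₂ , b₂) det≢0 w@(x , y) = begin
    det f v * D⁻¹ * (u · w) + det u f * D⁻¹ * (v · w)   ≡⟨ expand a₀ b₀ a₁ b₁ a₂ b₂ x y D⁻¹ ⟩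
    det u v * D⁻¹ * (f · w)                           ≡⟨ cong (_* (f · w)) (inverseʳ (det u v) det≢0) ⟩
    1# * (f · w)                                      ≡⟨ *-identityˡ _ ⟩
    f · w                                             ∎
    where
    D⁻¹ = det u v ⁻¹
    expand : ∀ a₀ b₀ a₁ b₁ a₂ b₂ x y i →
      (a₂ * b₁ - a₁ * b₂) * i * (a₀ * x + b₀ * y) + (a₀ * b₂ - a₂ * b₀) * i * (a₁ * x + b₁ * y)
        ≡ (a₀ * b₁ - a₁ * b₀) * i * (a₂ * x + b₂ * y)
    expand = solve 9 (λ a₀ b₀ a₁ b₁ a₂ b₂ x y i →
      (a₂ :* b₁ :- a₁ :* b₂) :* i :* (a₀ :* x :+ b₀ :* y) :+ (a₀ :* b₂ :- a₂ :* b₀) :* i :* (a₁ :* x :+ b₁ :* y)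
        := (a₀ :* b₁ :- a₁ :* b₀) :* i :* (a₂ :* x :+ b₂ :* y)) refl

  ·-injective : ∀ {u v} w w′ → det u v ≢ 0# → u · w ≡ u · w′ → v · w ≡ v · w′ → w ≡ w′
  ·-injective {u@(a , b)} {v@(c , d)} w@(x , y) w′@(x′ , y′) det≢0 u·w≡u·w′ v·w≡v·w′ = cong₂ _,_
    (*-cancelˡ (det u v) det≢0 (begin
      det u v * x                     ≡⟨ det*x≡ x y ⟩
      d * (u · w) - b * (v · w)       ≡⟨ cong₂ (λ p q → d * p - b * q) u·w≡u·w′ v·w≡v·w′ ⟩
      d * (u · w′) - b * (v · w′)     ≡⟨ det*x≡ x′ y′ ⟨
      det u v * x′                    ∎))
    (*-cancelˡ (det u v) det≢0 (begin
      det u v * y                     ≡⟨ det*y≡ x y ⟩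
      a * (v · w) - c * (u · w)       ≡⟨ cong₂ (λ p q → a * p - c * q) v·w≡v·w′ u·w≡u·w′ ⟩
      a * (v · w′) - c * (u · w′)     ≡⟨ det*y≡ x′ y′ ⟨
      det u v * y′                    ∎))
    where
    det*x≡ : ∀ x y → det u v * x ≡ d * (u · (x , y)) - b * (v · (x , y))
    det*x≡ = solve 6 (λ a b c d x y → (a :* d :- c :* b) :* x := d :* (a :* x :+ b :* y) :- b :* (c :* x :+ d :* y)) refl a b c d
    det*y≡ : ∀ x y → det u v * y ≡ a * (v · (x , y)) - c * (u · (x , y))
    det*y≡ = solve 6 (λ a b c d x y → (a :* d :- c :* b) :* y := a :* (c :* x :+ d :* y) :- c :* (a :* x :+ b :* y)) refl a b c d

module Norm (F : FiniteField) (σ : FiniteField.Carrier F → FiniteField.Carrier F) where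
  open Field F
  open ≡-Reasoning

  N : Carrier → Carrier
  N x = x * σ x

  N-* : (∀ x y → σ (x * y) ≡ σ x * σ y) → ∀ x y → N (x * y) ≡ N x * N y
  N-* σ-* x y = begin
    x * y * σ (x * y)        ≡⟨ cong (x * y *_) (σ-* x y) ⟩
    x * y * (σ x * σ y)      ≡⟨ solve 4 (λ x y a b → x :* y :* (a :* b) := x :* a :* (y :* b)) refl x y (σ x) (σ y) ⟩
    x * σ x * (y * σ y)      ∎

  -- With σ additive, (z - z′) (σ α z′ - α σ z) is a combination of
  -- N (α + z) - N (α + z′) and N z - N z′.
  N-collision : (∀ x y → σ (x + y) ≡ σ x + σ y) →
                ∀ α {z z′} → z ≢ z′ → N z ≡ N z′ → N (α + z) ≡ N (α + z′) → σ α * z′ ≡ α * σ z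
  N-collision σ-+ α {z} {z′} z≢z′ Nz≡Nz′ N[α+z]≡N[α+z′]
    with x*y≡0⇒x≡0⊎y≡0 (z - z′) (σ α * z′ - α * σ z) product≡0
    where
    P≡0 : (α + z) * (σ α + σ z) - (α + z′) * (σ α + σ z′) ≡ 0#
    P≡0 = x≈y⇒x∙y⁻¹≈ε (begin
      (α + z) * (σ α + σ z)     ≡⟨ cong ((α + z) *_) (σ-+ α z) ⟨
      N (α + z)                 ≡⟨ N[α+z]≡N[α+z′] ⟩
      N (α + z′)                ≡⟨ cong ((α + z′) *_) (σ-+ α z′) ⟩
      (α + z′) * (σ α + σ z′)   ∎)
    product≡0 : (z - z′) * (σ α * z′ - α * σ z) ≡ 0#
    product≡0 = begin
      (z - z′) * (σ α * z′ - α * σ z)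
        ≡⟨ solve 6 (λ z z′ s s′ α A → (z :- z′) :* (A :* z′ :- α :* s) :=
             z′ :* (((α :+ z) :* (A :+ s) :- (α :+ z′) :* (A :+ s′)) :- (z :* s :- z′ :* s′)) :- α :* (z :* s :- z′ :* s′))
             refl z z′ (σ z) (σ z′) α (σ α) ⟩
      z′ * (((α + z) * (σ α + σ z) - (α + z′) * (σ α + σ z′)) - (N z - N z′)) - α * (N z - N z′)
        ≡⟨ cong₂ (λ P Q → z′ * (P - Q) - α * Q) P≡0 (x≈y⇒x∙y⁻¹≈ε Nz≡Nz′) ⟩
      z′ * (0# - 0#) - α * 0#
        ≡⟨ solve 2 (λ z′ α → z′ :* (con (ℤ.+ 0) :- con (ℤ.+ 0)) :- α :* con (ℤ.+ 0) := con (ℤ.+ 0)) refl z′ α ⟩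
      0# ∎
  ... | inj₁ z-z′≡0 = ⊥-elim (z≢z′ (x∙y⁻¹≈ε⇒x≈y z z′ z-z′≡0))
  ... | inj₂ diff≡0  = x∙y⁻¹≈ε⇒x≈y _ _ diff≡0

module CommonNeighbourhood (F : FiniteField) {H : FiniteField.Carrier F → Bool} {s : ℕ}
                           (H-subgroup : IsSubgroupOfOrder F H s) where
  open Field F hiding (_×_)
  open import Data.Product using (_×_)
  open Plane F
  open IsSubgroupOfOrder H-subgroup
  open ≡-Reasoning

  encode : ∀ {m n} → Fin m × Fin n × Bool → Fin (m ℕ.* n ℕ.* 2)
  encode (i , j , b) = Fin.combine (Fin.combine i j) (Inverse.from Fin.2↔Bool b)

  encode-injective : ∀ {m n} (x y : Fin m × Fin n × Bool) → encode x ≡ encode y → x ≡ y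
  encode-injective (i , j , b) (i′ , j′ , b′) eq
    with Fin.combine-injective (Fin.combine i j) (Inverse.from Fin.2↔Bool b) (Fin.combine i′ j′) (Inverse.from Fin.2↔Bool b′) eq
  ... | ij≡i′j′ , b≡b′ with Fin.combine-injective i j i′ j′ ij≡i′j′
  ... | refl , refl = cong (λ b → i , j , b) (Injection.injective (↔⇒↣ (↔-sym Fin.2↔Bool)) b≡b′)

  V : Set
  V = NonzeroPair F H

  _≃_ : V → V → Set
  _≃_ = _∼_ F H

  point : V → Point
  point = proj₁

  _·∈H_ : V → V → Set
  u ·∈H w = H (point u · point w) ≡ true

  ·∈H⇒det≢0 : ∀ u v w → ¬ u ≃ v → u ·∈H w → v ·∈H w → det (point u) (point v) ≢ 0#
  ·∈H⇒det≢0 u@((a , b) , _) v@((c , d) , _) w u≄v u·w∈H v·w∈H det≡0 =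
    u≄v (h , mul-closed _ _ u·w∈H (inv-closed _ v·w∈H) , cong proj₁ u≡h⊙v , cong proj₂ u≡h⊙v)
    where
    h = point u · point w * (point v · point w) ⁻¹
    u≡h⊙v = det≡0⇒⊙ (point u) (point v) (point w) det≡0 (nonzero _ v·w∈H)

  module Bound (σ : Carrier → Carrier) (σ-+ : ∀ x y → σ (x + y) ≡ σ x + σ y) (σ-* : ∀ x y → σ (x * y) ≡ σ x * σ y)
               (σ-≢0 : ∀ {x} → x ≢ 0# → σ x ≢ 0#) {t : ℕ} (normClass : ∀ h → H h ≡ true → Fin t)
               (normClass-injective : ∀ {h h′} (h∈H : H h ≡ true) (h′∈H : H h′ ≡ true) →
                                      normClass h h∈H ≡ normClass h′ h′∈H → h * σ h ≡ h′ * σ h′) where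
    open Norm F σ

    module ThreeVertices (f₀ f₁ f₂ : V) (det₀₁≢0 : det (point f₀) (point f₁) ≢ 0#)
             (det₂₁≢0 : det (point f₂) (point f₁) ≢ 0#) (det₀₂≢0 : det (point f₀) (point f₂) ≢ 0#) where
      private
        p₀ = point f₀
        p₁ = point f₁
        p₂ = point f₂

      -- Cramer's rule: p₂ = α p₀ + β p₁.
      α β : Carrier
      α = det p₂ p₁ * det p₀ p₁ ⁻¹
      β = det p₀ p₂ * det p₀ p₁ ⁻¹

      α≢0 : α ≢ 0#
      α≢0 = x*y≢0 det₂₁≢0 (x⁻¹≢0 det₀₁≢0)

      β≢0 : β ≢ 0#
      β≢0 = x*y≢0 det₀₂≢0 (x⁻¹≢0 det₀₁≢0)

      partner : Carrier → Carrier
      partner z = α * σ z * σ α ⁻¹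

      collision⇒partner : ∀ {z z′} → z ≢ z′ → N z ≡ N z′ → N (α + z) ≡ N (α + z′) → z′ ≡ partner z
      collision⇒partner {z} {z′} z≢z′ Nz≡Nz′ N[α+z]≡N[α+z′] = begin
        z′                       ≡⟨ x*y*y⁻¹≡x z′ (σ-≢0 α≢0) ⟨
        z′ * σ α * σ α ⁻¹        ≡⟨ cong (_* σ α ⁻¹) (≡.trans (*-comm z′ (σ α)) (N-collision σ-+ α z≢z′ Nz≡Nz′ N[α+z]≡N[α+z′])) ⟩
        α * σ z * σ α ⁻¹         ∎

      side : Carrier → Bool
      side z = does (index z Fin.<? index (partner z))

      -- Two colliding values are each other's partner, so comparing each with
      -- its partner gives opposite answers.
      side-separates : ∀ {z z′} → N z ≡ N z′ → N (α + z) ≡ N (α + z′) → side z ≡ side z′ → z ≡ z′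
      side-separates {z} {z′} Nz≡Nz′ N[α+z]≡N[α+z′] side≡ with z ≟ z′
      ... | yes z≡z′ = z≡z′
      ... | no  z≢z′ = ⊥-elim (does-<?-asym (z≢z′ ∘ index-injective) (begin
        does (index z Fin.<? index z′)   ≡⟨ cong (λ u → does (index z Fin.<? index u)) (collision⇒partner z≢z′ Nz≡Nz′ N[α+z]≡N[α+z′]) ⟩
        side z                           ≡⟨ side≡ ⟩
        side z′                          ≡⟨ cong (λ u → does (index z′ Fin.<? index u))
                                                 (collision⇒partner (z≢z′ ∘ ≡.sym) (≡.sym Nz≡Nz′) (≡.sym N[α+z]≡N[α+z′])) ⟨
        does (index z′ Fin.<? index z)   ∎))

      IsCommonNeighbour : V → Set
      IsCommonNeighbour w = f₀ ·∈H w × f₁ ·∈H w × f₂ ·∈H w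

      ratio : V → Carrier
      ratio w = p₁ · point w * (p₀ · point w) ⁻¹

      ratio∈H : ∀ w → IsCommonNeighbour w → H (ratio w) ≡ true
      ratio∈H w (f₀·w∈H , f₁·w∈H , _) = mul-closed _ _ f₁·w∈H (inv-closed _ f₀·w∈H)

      α+β*ratio∈H : ∀ w → IsCommonNeighbour w → H (α + β * ratio w) ≡ true
      α+β*ratio∈H w (f₀·w∈H , _ , f₂·w∈H) = subst (λ x → H x ≡ true) (≡.sym α+β*ratio≡) (mul-closed _ _ f₂·w∈H (inv-closed _ f₀·w∈H))
        where
        U₀ = p₀ · point w
        U₁ = p₁ · point w
        α+β*ratio≡ : α + β * ratio w ≡ p₂ · point w * U₀ ⁻¹
        α+β*ratio≡ = begin
          α + β * (U₁ * U₀ ⁻¹)                    ≡⟨ cong (λ e → e + β * (U₁ * U₀ ⁻¹)) (x*y*y⁻¹≡x α (nonzero _ f₀·w∈H)) ⟨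
          α * U₀ * U₀ ⁻¹ + β * (U₁ * U₀ ⁻¹)        ≡⟨ solve 5 (λ a b x y i → a :* x :* i :+ b :* (y :* i) := (a :* x :+ b :* y) :* i) refl α β U₀ U₁ (U₀ ⁻¹) ⟩
          (α * U₀ + β * U₁) * U₀ ⁻¹                ≡⟨ cong (_* U₀ ⁻¹) (cramer p₀ p₁ p₂ det₀₁≢0 (point w)) ⟩
          p₂ · point w * U₀ ⁻¹                    ∎

      ratio-injective : ∀ w w′ → IsCommonNeighbour w → IsCommonNeighbour w′ → ratio w ≡ ratio w′ → w ≃ w′
      ratio-injective w@((x , y) , _) w′@((x′ , y′) , _) (f₀·w∈H , _) (f₀·w′∈H , _) r≡r′ =
        λ′ , mul-closed _ _ f₀·w∈H (inv-closed _ f₀·w′∈H) , cong proj₁ w≡λ′⊙w′ , cong proj₂ w≡λ′⊙w′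
        where
        U₀ = p₀ · point w
        U₁ = p₁ · point w
        U₀′ = p₀ · point w′
        U₁′ = p₁ · point w′
        λ′ = U₀ * U₀′ ⁻¹
        w≡λ′⊙w′ : point w ≡ λ′ ⊙ point w′
        w≡λ′⊙w′ = ·-injective (point w) (λ′ ⊙ point w′) det₀₁≢0
          (begin
            U₀                        ≡⟨ x*y⁻¹*y≡x U₀ (nonzero _ f₀·w′∈H) ⟨
            λ′ * U₀′                  ≡⟨ ·-⊙ p₀ λ′ (point w′) ⟨
            p₀ · (λ′ ⊙ point w′)      ∎)
          (begin
            U₁                        ≡⟨ x*y⁻¹*y≡x U₁ (nonzero _ f₀·w∈H) ⟨
            U₁ * U₀ ⁻¹ * U₀           ≡⟨ cong (_* U₀) r≡r′ ⟩
            U₁′ * U₀′ ⁻¹ * U₀         ≡⟨ solve 3 (λ a i b → a :* i :* b := b :* i :* a) refl U₁′ (U₀′ ⁻¹) U₀ ⟩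
            λ′ * U₁′                  ≡⟨ ·-⊙ p₁ λ′ (point w′) ⟨
            p₁ · (λ′ ⊙ point w′)      ∎)

      classes : ∀ w → IsCommonNeighbour w → Fin t × Fin t × Bool
      classes w cw = normClass (ratio w) (ratio∈H w cw) , normClass (α + β * ratio w) (α+β*ratio∈H w cw) , side (β * ratio w)

      classes-injective : ∀ w w′ (cw : IsCommonNeighbour w) (cw′ : IsCommonNeighbour w′) →
                          classes w cw ≡ classes w′ cw′ → w ≃ w′
      classes-injective w w′ cw cw′ classes≡ =
        ratio-injective w w′ cw cw′ (*-cancelˡ β β≢0 (side-separates N[βr]≡N[βr′] N[α+βr]≡N[α+βr′] (cong (proj₂ ∘ proj₂) classes≡)))
        where
        N[α+βr]≡N[α+βr′] : N (α + β * ratio w) ≡ N (α + β * ratio w′)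
        N[α+βr]≡N[α+βr′] = normClass-injective (α+β*ratio∈H w cw) (α+β*ratio∈H w′ cw′) (cong (proj₁ ∘ proj₂) classes≡)
        N[βr]≡N[βr′] : N (β * ratio w) ≡ N (β * ratio w′)
        N[βr]≡N[βr′] = begin
          N (β * ratio w)      ≡⟨ N-* σ-* β (ratio w) ⟩
          N β * N (ratio w)    ≡⟨ cong (N β *_) (normClass-injective (ratio∈H w cw) (ratio∈H w′ cw′) (cong proj₁ classes≡)) ⟩
          N β * N (ratio w′)   ≡⟨ N-* σ-* β (ratio w′) ⟨
          N (β * ratio w′)     ∎

    K₃,ₙ⇒n≤t*t*2 : ∀ {n} → ContainsK (GQs F H) 3 n → n ℕ.≤ t ℕ.* t ℕ.* 2
    K₃,ₙ⇒n≤t*t*2 {zero}  _                                  = ℕ.z≤n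
    K₃,ₙ⇒n≤t*t*2 {suc n} (f , g , f-injective , g-injective , _ , adjacent) =
      Fin.injective⇒≤ {f = λ j → encode (classes (g j) (common j))}
        (λ {i} {j} code≡ → g-injective i j (classes-injective (g i) (g j) (common i) (common j) (encode-injective _ _ code≡)))
      where
      linked : ∀ i j → f i ·∈H g j
      linked i j = proj₂ (adjacent i j)
      det≢0 : ∀ i j → i ≢ j → det (point (f i)) (point (f j)) ≢ 0#
      det≢0 i j i≢j = ·∈H⇒det≢0 (f i) (f j) (g 0F) (i≢j ∘ f-injective i j) (linked i 0F) (linked j 0F)
      open ThreeVertices (f 0F) (f 1F) (f 2F) (det≢0 0F 1F (λ ())) (det≢0 2F 1F (λ ())) (det≢0 0F 2F (λ ()))
      common : ∀ j → IsCommonNeighbour (g j)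
      common j = linked 0F j , linked 1F j , linked 2F j

open import Data.Nat using (_+_; _*_; _^_; _≥_)

2*t²+1≰t*t*2 : ∀ t → ¬ (2 * t ^ 2 + 1 ℕ.≤ t * t * 2)
2*t²+1≰t*t*2 t 2t²+1≤ = ℕ.<-irrefl refl (ℕ.≤-trans (ℕ.≤-reflexive (ℕ.+-comm 1 (2 * t ^ 2))) (ℕ.≤-trans 2t²+1≤ (ℕ.≤-reflexive t*t*2≡2*t²)))
  where
  open ≡-Reasoning
  t*t*2≡2*t² : t * t * 2 ≡ 2 * t ^ 2
  t*t*2≡2*t² = begin
    t * t * 2          ≡⟨ ℕ.*-comm (t * t) 2 ⟩
    2 * (t * t)        ≡⟨ cong (λ x → 2 * (t * x)) (ℕ.*-identityʳ t) ⟨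
    2 * t ^ 2          ∎

theorem5 : (q t : ℕ) → IsPrimePower q → t ≥ 1 → t ∣ q ∸ 1 →
    (F : FiniteField) → FiniteField.order F ≡ q ^ 2 →
    (H : FiniteField.Carrier F → Bool) → IsSubgroupOfOrder F H (t * (q + 1)) →
    KFree (GQs F H) 3 (2 * t ^ 2 + 1)
theorem5 q t@(suc t-1) (p , k@(suc k-1) , p-prime , _ , refl) _ _ F |F|≡q² H H-subgroup K₃,₂ₜ²₊₁ =
  2*t²+1≰t*t*2 t (K₃,ₙ⇒n≤t*t*2 K₃,₂ₜ²₊₁)
  where
  -- The unused hypothesis t ∣ q ∸ 1 only guarantees that such an H exists.
  module 𝔽 = Field F
  open 𝔽 using (1#; ^-assocʳ)
  open Frobenius F using (frobenius-^; prime-power-order⇒p×1≡0)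
  open Lagrange F H-subgroup using (x∈H⇒x^s≡1)
  open Polynomial.RootsOfUnity F t-1 using (rootIndex; rootIndex-injective)
  N[h]ᵗ≡1 : ∀ h → H h ≡ true → (h 𝔽.^ suc q) 𝔽.^ t ≡ 1#
  N[h]ᵗ≡1 h h∈H = ≡.trans (^-assocʳ h (suc q) t) (≡.trans (cong (h 𝔽.^_) (≡.trans (ℕ.*-comm (suc q) t) (cong (t *_) (ℕ.+-comm 1 q))))
                                                      (x∈H⇒x^s≡1 h h∈H))
  open CommonNeighbourhood.Bound F H-subgroup (𝔽._^ q)
    (frobenius-^ p-prime (prime-power-order⇒p×1≡0 {p} {suc (k-1 * 2)} (≡.trans |F|≡q² (ℕ.^-*-assoc p k 2))) k)
    (λ x y → 𝔽.^-distrib-* x y q) (𝔽.x^n≢0 q)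
    (λ h h∈H → rootIndex (h 𝔽.^ suc q) (N[h]ᵗ≡1 h h∈H)) (λ h∈H h′∈H → rootIndex-injective _ _)
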